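{- Let $G$ be a connected Eulerian ribbon graph. Then there are exactly $2^{|V(G)|-1}$ subsets $A\subseteq E(G)$ for which the partial Petrial $G^{\tau(A)}$ is checkerboard colourable (that is, $G$ has $2^{|V(G)|-1}$ checkerboard colourable partial Petrials, some of which may be equivalent).
   Context: A ribbon graph is a (possibly non-orientable) surface with boundary written as a union of vertex discs $V(G)$ and edge discs $E(G)$ meeting in disjoint line segments (common line segments), each lying on exactly one vertex and one edge, each edge containing exactly two. Edge line segments: the two boundary arcs of an edge disc other than its common line segments. The degree of a vertex is the number of common line segments on it; $G$ is Eulerian if all degrees are even. $G$ is checkerboard colourable if its boundary components can be coloured with two colours so that the two edge line segments of each edge receive different colours. The partial Petrial $G^{\tau(A)}$ is obtained from $G$ by giving a half-twist to each edge in $A$ (in an arrow presentation: reversing one of the two marking arrows of each edge of $A$). -}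

module Defs where

open import Data.Nat using (ℕ; _≤_)
open import Data.Nat.Divisibility using (_∣_)
open import Data.Bool using (Bool; true; false; not; _xor_)
open import Data.Fin using (Fin)
open import Data.Fin.Subset using (Subset)
open import Data.Vec using (lookup)
open import Data.Product using (_×_; _,_; Σ; Σ-syntax)
open import Data.Sum using (_⊎_)
open import Data.List using (List; length; filter; cartesianProduct; allFin)
open import Data.List.Membership.Propositional using (_∈_)
open import Data.List.Relation.Unary.Unique.Propositional using (Unique)
open import Relation.Binary.PropositionalEquality using (_≡_; _≢_)
open import Relation.Binary.Construct.Closure.ReflexiveTransitive using (Star)
open import Function.Bundles using (_⇔_)
open import Data.Fin using (_≟_)

-- Combinatorial (graph-encoded-map / flag) model of a ribbon graph.
--
-- Each edge disc is a rectangle with two common line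
-- segments ("ends", i : Bool).  A corner (e , i , s) is the endpoint on
-- side s of the common line segment at end i of edge e.  So corners are
-- the points where common line segments, edge line segments and vertex
-- boundary arcs meet.
--   α : joins the two endpoints of one common line segment (fixed);
--   λ : joins the two endpoints of one edge line segment; it pairs end i
--       with end (not i), and for a twisted labelling swaps sides:
--       λ (e , i , s) = (e , not i , s xor twist e);
--   ν : joins the two endpoints of one vertex-boundary arc (an arbitrary
--       fixed-point-free involution on corners).
-- Vertices = orbits of ⟨α , ν⟩ (plus isolated vertices, degree 0);
-- boundary components = orbits of ⟨λ , ν⟩.

Corner : ℕ → Set
Corner m = Fin m × Bool × Bool

α : ∀ {m} → Corner m → Corner m
α (e , i , s) = (e , i , not s)

λ-of : ∀ {m} → (Fin m → Bool) → Corner m → Corner m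
λ-of t (e , i , s) = (e , not i , s xor t e)

VStep : ∀ {m} → (Corner m → Corner m) → Corner m → Corner m → Set
VStep ν d d' = (d' ≡ α d) ⊎ (d' ≡ ν d)

AStep : ∀ {m} → (Fin m → Bool) → (Corner m → Corner m) → Corner m → Corner m → Set
AStep t ν d d' = (d' ≡ α d) ⊎ ((d' ≡ λ-of t d) ⊎ (d' ≡ ν d))

record RibbonGraph : Set where
  field
    nE     : ℕ
    nV     : ℕ
    twist  : Fin nE → Bool
    ν      : Corner nE → Corner nE
    ν-invol : ∀ d → ν (ν d) ≡ d
    ν-fpf   : ∀ d → ν d ≢ d
    -- the vertex on which a corner lies; vertices not hit are isolated
    vertOf : Corner nE → Fin nV
    vertOf-orbit : ∀ d d' → (vertOf d ≡ vertOf d') ⇔ Star (VStep ν) d d'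

open RibbonGraph public

lam : (G : RibbonGraph) → Corner (nE G) → Corner (nE G)
lam G = λ-of (twist G)

degree : (G : RibbonGraph) → Fin (nV G) → ℕ
degree G u = length (filter (λ p → vertOf G (Data.Product.proj₁ p , Data.Product.proj₂ p , false) ≟ u)
                            (cartesianProduct (allFin (nE G)) (true Data.List.∷ false Data.List.∷ Data.List.[])))

Eulerian : RibbonGraph → Set
Eulerian G = ∀ u → 2 ∣ degree G u

VConnected : (G : RibbonGraph) → Fin (nV G) → Fin (nV G) → Set
VConnected G u w = (u ≡ w) ⊎ (Σ[ d ∈ Corner (nE G) ] Σ[ d' ∈ Corner (nE G) ]
  (vertOf G d ≡ u × vertOf G d' ≡ w × Star (AStep (twist G) (ν G)) d d'))

Connected : RibbonGraph → Set
Connected G = (1 ≤ nV G) × (∀ u w → VConnected G u w)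

-- a 2-colouring of the boundary components (a colour for each corner,
-- constant along boundary components, i.e. invariant under λ and ν) such
-- that the two edge line segments {d , λ d} and {α d , λ (α d)} of each
-- edge get different colours
CheckerboardColourable : RibbonGraph → Set
CheckerboardColourable G =
  Σ[ c ∈ (Corner (nE G) → Bool) ]
    ((∀ d → c (lam G d) ≡ c d) × (∀ d → c (ν G d) ≡ c d) × (∀ d → c (α d) ≢ c d))

partialPetrial : (G : RibbonGraph) → Subset (nE G) → RibbonGraph
partialPetrial G A = record G { twist = λ e → twist G e xor lookup A e }

-- Around a vertex, σ = ν ∘ α visits one endpoint of every common line segment on it, so the
-- period of σ on a corner is the degree of its vertex.  When every degree is even, colouring each
-- corner by the parity of its position on that cycle gives a colouring p that is constant along
-- vertex arcs and changes across every common line segment ("alternating"), and every alternating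
-- colouring is p flipped on a set x of vertices.  An alternating colouring c is a checkerboard
-- colouring of exactly one partial Petrial: the one in which e is twisted iff c takes different
-- values on the same side of the two ends of e.  For c = p flipped on x, that edge set differs
-- from the one for p by the coboundary of x.  Connectedness makes the coboundary vanish only for x = ∅ and x = V(G), so
-- the 2^|V(G)| sets x give 2^(|V(G)| - 1) distinct colourable partial Petrials.
module Submission where

open import Defs

open import Algebra.Bundles using (CommutativeRing)
import Algebra.Properties.AbelianGroup as AbelianGroupProperties
import Algebra.Properties.CommutativeSemigroup as CommutativeSemigroupProperties
open import Data.Bool as Bool using (Bool; true; false; not; _xor_)
open import Data.Bool.Properties
  using ( xor-∧-commutativeRing; xor-assoc; xor-comm; xor-same; xor-identityʳ; xor-annihilates-not
        ; not-distribˡ-xor; not-involutive; ¬-not; not-¬)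
open import Data.Fin as Fin using (Fin; zero; suc; toℕ; fromℕ<)
open import Data.Fin.Properties
  using ( any?; inj⇒≟; pigeonhole; ¬∀⟶∃¬-smallest; toℕ<n; toℕ-injective; toℕ-fromℕ<; toℕ-inject
        ; *↔×; 2↔Bool)
open import Data.Fin.Subset using (Subset)
open import Data.List using (List; []; _∷_; [_]; _++_; map; length; filter; cartesianProduct; allFin; tabulate)
open import Data.List.Properties using (length-map; length-++; length-tabulate)
open import Data.List.Membership.Propositional using (_∈_)
open import Data.List.Membership.Propositional.Properties
  using ( ∈-map⁺; ∈-map⁻; ∈-++⁺ˡ; ∈-++⁺ʳ; ∈-filter⁺; ∈-filter⁻; ∈-tabulate⁺; ∈-tabulate⁻
        ; ∈-cartesianProduct⁺; ∈-allFin)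
open import Data.List.Membership.Propositional.Properties.WithK using (unique∧set⇒bag)
open import Data.List.Relation.Binary.BagAndSetEquality using (∼bag⇒↭)
open import Data.List.Relation.Binary.Permutation.Propositional.Properties using (↭-length)
open import Data.List.Relation.Unary.All using ([]; _∷_)
open import Data.List.Relation.Unary.AllPairs using ([]; _∷_)
open import Data.List.Relation.Unary.Any using (here; there)
open import Data.List.Relation.Unary.Unique.Propositional using (Unique)
import Data.List.Relation.Unary.Unique.Propositional.Properties as Unique
open import Data.Nat using (ℕ; zero; suc; _+_; _*_; _^_; _∸_; _≤_; _<_; s≤s; s≤s⁻¹; z≤n; NonZero)
open import Data.Nat.DivMod using (_%_; _/_; m≡m%n+[m/n]*n; m%n<n)
open import Data.Nat.Divisibility using (_∣_; divides; ∣n⇒∣m*n)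
open import Data.Nat.GeneralisedArithmetic using (fold; fold-+; iterate; iterate-is-fold)
open import Data.Nat.Properties
  using (+-identityʳ; +-suc; +-assoc; +-comm; *-suc; n<1+n; m≤n⇒∃[o]m+o≡n; ≤-trans; ≤-reflexive; m≤n+m; <-cmp)
open import Data.Product using (Σ; Σ-syntax; ∃-syntax; _×_; _,_; proj₁; proj₂)
open import Data.Product.Function.NonDependent.Propositional using (_×-↔_)
open import Data.Product.Properties using (≡-dec)
open import Data.Sum using (_⊎_; inj₁; inj₂)
open import Data.Vec using (Vec; lookup) renaming (tabulate to tabulateᵥ; [] to []ᵥ; _∷_ to _∷ᵥ_)
open import Data.Vec.Properties using (∷-injectiveʳ; lookup∘tabulate; tabulate∘lookup; tabulate-cong)
open import Function.Bundles using (_⇔_; mk⇔; Equivalence; _↔_; Inverse; _↣_; Injection)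
open import Function.Construct.Composition using (_⇔-∘_)
open import Function.Construct.Symmetry using (⇔-sym)
open import Function.Properties.Inverse using (↔-sym; ↔-trans; ↔-refl; ↔⇒↣)
open import Relation.Binary.Construct.Closure.ReflexiveTransitive using (Star; ε; _◅_)
open import Relation.Binary.Definitions using (DecidableEquality; tri<; tri≈; tri>)
open import Relation.Binary.PropositionalEquality
  using (_≡_; _≢_; refl; sym; trans; cong; cong₂; cong-app; subst; module ≡-Reasoning)
open import Relation.Nullary using (¬_; ¬?; Dec; yes; no; contradiction)
open import Relation.Nullary.Decidable using (decidable-stable)

open CommutativeRing xor-∧-commutativeRing using (+-abelianGroup; +-commutativeSemigroup)
open AbelianGroupProperties +-abelianGroup using (x∙y⁻¹≈ε⇒x≈y; x≈y⇒x∙y⁻¹≈ε)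
open CommutativeSemigroupProperties +-commutativeSemigroup using (interchange)

xor-cancelˡ : ∀ x y → x xor (x xor y) ≡ y
xor-cancelˡ x y = trans (sym (xor-assoc x x y)) (cong (_xor y) (xor-same x))

xor-cancelʳ : ∀ x y → (x xor y) xor y ≡ x
xor-cancelʳ x y = trans (xor-assoc x y y) (trans (cong (x xor_) (xor-same y)) (xor-identityʳ x))

xor-exchange : ∀ x {y z} → x xor y ≡ z → x xor z ≡ y
xor-exchange x {y} refl = xor-cancelˡ x y

xor-cancelˡ-≡ : ∀ x {y z} → x xor y ≡ x xor z → y ≡ z
xor-cancelˡ-≡ x {y} {z} eq = trans (sym (xor-cancelˡ x y)) (trans (cong (x xor_) eq) (xor-cancelˡ x z))

xor-transpose : ∀ u v u′ v′ → u xor v ≡ u′ xor v′ → u xor u′ ≡ v xor v′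
xor-transpose u v u′ v′ eq =
  x∙y⁻¹≈ε⇒x≈y _ _ (trans (interchange u u′ v v′) (x≈y⇒x∙y⁻¹≈ε eq))

odd : ℕ → Bool
odd zero = false
odd (suc n) = not (odd n)

odd-+ : ∀ m n → odd (m + n) ≡ odd m xor odd n
odd-+ zero n = refl
odd-+ (suc m) n = trans (cong not (odd-+ m n)) (not-distribˡ-xor (odd m) (odd n))

odd-even : ∀ {n} → 2 ∣ n → odd n ≡ false
odd-even (divides q refl) = odd-double q
  where
    odd-double : ∀ q → odd (q * 2) ≡ false
    odd-double zero = refl
    odd-double (suc q) = trans (not-involutive (odd (q * 2))) (odd-double q)

odd-% : ∀ n k .{{_ : NonZero k}} → 2 ∣ k → odd (n % k) ≡ odd n
odd-% n k 2∣k = sym (begin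
  odd n                                ≡⟨ cong odd (m≡m%n+[m/n]*n n k) ⟩
  odd (n % k + (n / k) * k)            ≡⟨ odd-+ (n % k) ((n / k) * k) ⟩
  odd (n % k) xor odd ((n / k) * k)    ≡⟨ cong (odd (n % k) xor_) (odd-even (∣n⇒∣m*n (n / k) 2∣k)) ⟩
  odd (n % k) xor false                ≡⟨ xor-identityʳ (odd (n % k)) ⟩
  odd (n % k)                          ∎)
  where open ≡-Reasoning

tabulate-≡⇔ : ∀ {n} {A : Set} {f g : Fin n → A} → tabulateᵥ f ≡ tabulateᵥ g ⇔ (∀ i → f i ≡ g i)
tabulate-≡⇔ {f = f} {g} = mk⇔
  (λ eq i → trans (sym (lookup∘tabulate f i)) (trans (cong (λ v → lookup v i) eq) (lookup∘tabulate g i)))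
  tabulate-cong

Constant : {A B : Set} → (A → B) → Set
Constant f = ∀ u w → f u ≡ f w

bitVectors : ∀ n → List (Vec Bool n)
bitVectors zero = [ []ᵥ ]
bitVectors (suc n) = map (true ∷ᵥ_) (bitVectors n) ++ map (false ∷ᵥ_) (bitVectors n)

length-bitVectors : ∀ n → length (bitVectors n) ≡ 2 ^ n
length-bitVectors zero = refl
length-bitVectors (suc n) = begin
  length (map (true ∷ᵥ_) vs ++ map (false ∷ᵥ_) vs)    ≡⟨ length-++ (map (true ∷ᵥ_) vs) ⟩
  length (map (true ∷ᵥ_) vs) + length (map (false ∷ᵥ_) vs)
    ≡⟨ cong₂ _+_ (length-map (true ∷ᵥ_) vs) (length-map (false ∷ᵥ_) vs) ⟩
  length vs + length vs                               ≡⟨ cong (λ l → l + l) (length-bitVectors n) ⟩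
  2 ^ n + 2 ^ n                                       ≡⟨ cong (2 ^ n +_) (sym (+-identityʳ (2 ^ n))) ⟩
  2 ^ suc n                                           ∎
  where
    open ≡-Reasoning
    vs : List (Vec Bool n)
    vs = bitVectors n

∈-bitVectors : ∀ {n} (v : Vec Bool n) → v ∈ bitVectors n
∈-bitVectors []ᵥ = here refl
∈-bitVectors (true ∷ᵥ v) = ∈-++⁺ˡ (∈-map⁺ (true ∷ᵥ_) (∈-bitVectors v))
∈-bitVectors {suc n} (false ∷ᵥ v) =
  ∈-++⁺ʳ (map (true ∷ᵥ_) (bitVectors n)) (∈-map⁺ (false ∷ᵥ_) (∈-bitVectors v))

bitVectors-unique : ∀ n → Unique (bitVectors n)
bitVectors-unique zero = [] ∷ []
bitVectors-unique (suc n) =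
  Unique.++⁺ (Unique.map⁺ ∷-injectiveʳ (bitVectors-unique n))
             (Unique.map⁺ ∷-injectiveʳ (bitVectors-unique n))
             heads-differ
  where
    heads-differ : ∀ {v} → ¬ (v ∈ map (true ∷ᵥ_) (bitVectors n) × v ∈ map (false ∷ᵥ_) (bitVectors n))
    heads-differ (v∈t , v∈f) with ∈-map⁻ (true ∷ᵥ_) v∈t | ∈-map⁻ (false ∷ᵥ_) v∈f
    ... | _ , _ , refl | _ , _ , ()

image-size-modulo-constants :
  ∀ {N} {B : Set} → 1 ≤ N → (Φ : (Fin N → Bool) → B) →
  (∀ x x′ → Φ x ≡ Φ x′ ⇔ Constant (λ v → x v xor x′ v)) →
  Σ[ L ∈ List B ] (Unique L × length L ≡ 2 ^ (N ∸ 1) × (∀ b → b ∈ L ⇔ (∃[ x ] Φ x ≡ b)))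
image-size-modulo-constants {suc n} {B} (s≤s z≤n) Φ Φ-≡⇔ =
  L , Unique.map⁺ Ψ-injective (bitVectors-unique n)
    , trans (length-map Ψ (bitVectors n)) (length-bitVectors n)
    , λ b → mk⇔ (∈L⇒image b) (image⇒∈L b)
  where
    -- every class {x , not ∘ x} has exactly one member with x zero ≡ false
    extend : Vec Bool n → Fin (suc n) → Bool
    extend y = lookup (false ∷ᵥ y)

    Ψ : Vec Bool n → B
    Ψ y = Φ (extend y)

    L : List B
    L = map Ψ (bitVectors n)

    Ψ-injective : ∀ {y y′} → Ψ y ≡ Ψ y′ → y ≡ y′
    Ψ-injective {y} {y′} eq = begin
      y                       ≡⟨ tabulate∘lookup y ⟨
      tabulateᵥ (lookup y)    ≡⟨ tabulate-cong (λ j → x∙y⁻¹≈ε⇒x≈y _ _ (Equivalence.to (Φ-≡⇔ _ _) eq (suc j) zero)) ⟩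
      tabulateᵥ (lookup y′)   ≡⟨ tabulate∘lookup y′ ⟩
      y′                      ∎
      where open ≡-Reasoning

    ∈L⇒image : ∀ b → b ∈ L → ∃[ x ] Φ x ≡ b
    ∈L⇒image b b∈L with ∈-map⁻ Ψ b∈L
    ... | y , _ , refl = extend y , refl

    image⇒∈L : ∀ b → ∃[ x ] Φ x ≡ b → b ∈ L
    image⇒∈L b (x , refl) = subst (_∈ L) (Equivalence.from (Φ-≡⇔ _ _) constant) (∈-map⁺ Ψ (∈-bitVectors normal))
      where
        normal : Vec Bool n
        normal = tabulateᵥ (λ j → x zero xor x (suc j))

        differs-by-x₀ : ∀ v → extend normal v xor x v ≡ x zero
        differs-by-x₀ zero = refl
        differs-by-x₀ (suc j) =
          trans (cong (_xor x (suc j)) (lookup∘tabulate _ j)) (xor-cancelʳ (x zero) (x (suc j)))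

        constant : Constant (λ v → extend normal v xor x v)
        constant u w = trans (differs-by-x₀ u) (sym (differs-by-x₀ w))

module _ {X V : Set} {N : ℕ} (X↔Fin : X ↔ Fin N) (_≟_ : DecidableEquality V) (g : X → V) where
  open Inverse X↔Fin using (to; from; inverseʳ)

  pickOver : {B : Set} → (X → B) → B → V → B
  pickOver h b v with any? (λ i → g (from i) ≟ v)
  ... | yes (i , _) = h (from i)
  ... | no _ = b

  pickOver-spec : ∀ {B : Set} (h : X → B) b x → ∃[ y ] g y ≡ g x × pickOver h b (g x) ≡ h y
  pickOver-spec h b x with any? (λ i → g (from i) ≟ g x)
  ... | yes (i , gi≡gx) = from i , gi≡gx , refl
  ... | no none = contradiction (to x , cong g (inverseʳ refl)) none

module Cycle {X : Set} {N : ℕ} (X↣Fin : X ↣ Fin N) (f : X → X)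
             (f-injective : ∀ {y z} → f y ≡ f z → y ≡ z) (x : X) where

  orbit : ℕ → X
  orbit j = fold x f j

  fold-injective : ∀ j {y z} → fold y f j ≡ fold z f j → y ≡ z
  fold-injective zero eq = eq
  fold-injective (suc j) eq = fold-injective j (f-injective eq)

  orbit-+ : ∀ a b → orbit (a + b) ≡ fold (orbit b) f a
  orbit-+ a b = fold-+ x f a

  Returns : ℕ → Set
  Returns c = orbit (suc c) ≡ x

  private
    _≟_ : DecidableEquality X
    _≟_ = inj⇒≟ X↣Fin

  abstract
    returns-early : ∃[ c ] c < N × Returns c
    returns-early with pigeonhole (n<1+n N) (λ i → Injection.to X↣Fin (orbit (toℕ i)))
    ... | i , j , i<j , same with m≤n⇒∃[o]m+o≡n i<j
    ... | c , i+1+c≡j = c , c<N , fold-injective (toℕ i) (begin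
        fold (orbit (suc c)) f (toℕ i)  ≡⟨ orbit-+ (toℕ i) (suc c) ⟨
        orbit (toℕ i + suc c)           ≡⟨ cong orbit (trans (+-suc (toℕ i) c) i+1+c≡j) ⟩
        orbit (toℕ j)                   ≡⟨ Injection.injective X↣Fin same ⟨
        orbit (toℕ i)                   ∎)
      where
        open ≡-Reasoning
        c<N : c < N
        c<N = ≤-trans (s≤s (m≤n+m c (toℕ i))) (≤-trans (≤-reflexive i+1+c≡j) (s≤s⁻¹ (toℕ<n j)))

    least-return : ∃[ c ] Returns c × (∀ j → j < c → ¬ Returns j)
    least-return with returns-early
    ... | c , c<N , returns-c
      with ¬∀⟶∃¬-smallest N (λ i → ¬ Returns (toℕ i)) (λ i → ¬? (orbit (suc (toℕ i)) ≟ x))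
             (λ never → never (fromℕ< c<N) (subst Returns (sym (toℕ-fromℕ< c<N)) returns-c))
    ... | i , returns-i , earlier =
      toℕ i , decidable-stable (orbit (suc (toℕ i)) ≟ x) returns-i , not-earlier
      where
        not-earlier : ∀ j → j < toℕ i → ¬ Returns j
        not-earlier j j<i = subst (λ j → ¬ Returns j) (trans (toℕ-inject (fromℕ< j<i)) (toℕ-fromℕ< j<i))
                                  (earlier (fromℕ< j<i))

  period : ℕ
  period = suc (proj₁ least-return)

  instance
    period-nonZero : NonZero period
    period-nonZero = _

  orbit-period : orbit period ≡ x
  orbit-period = proj₁ (proj₂ least-return)

  orbit-multiple : ∀ q → orbit (q * period) ≡ x
  orbit-multiple zero = refl
  orbit-multiple (suc q) = begin
    orbit (period + q * period)        ≡⟨ orbit-+ period (q * period) ⟩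
    fold (orbit (q * period)) f period ≡⟨ cong (λ y → fold y f period) (orbit-multiple q) ⟩
    orbit period                       ≡⟨ orbit-period ⟩
    x                                  ∎
    where open ≡-Reasoning

  orbit-periodic : ∀ a q → orbit (a + q * period) ≡ orbit a
  orbit-periodic a q = trans (orbit-+ a (q * period)) (cong (λ y → fold y f a) (orbit-multiple q))

  orbit-% : ∀ j → orbit (j % period) ≡ orbit j
  orbit-% j = trans (sym (orbit-periodic (j % period) (j / period))) (cong orbit (sym (m≡m%n+[m/n]*n j period)))

  private
    no-early-repeat : ∀ {a b} → a < b → b < period → orbit a ≢ orbit b
    no-early-repeat {a} {b} a<b b<period same with m≤n⇒∃[o]m+o≡n a<b
    ... | o , a+1+o≡b = proj₂ (proj₂ least-return) o o<period∸1 (fold-injective a (begin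
        fold (orbit (suc o)) f a  ≡⟨ orbit-+ a (suc o) ⟨
        orbit (a + suc o)         ≡⟨ cong orbit (trans (+-suc a o) a+1+o≡b) ⟩
        orbit b                   ≡⟨ same ⟨
        orbit a                   ∎))
      where
        open ≡-Reasoning
        o<period∸1 : o < period ∸ 1
        o<period∸1 = ≤-trans (s≤s (m≤n+m o a)) (≤-trans (≤-reflexive a+1+o≡b) (s≤s⁻¹ b<period))

  orbit-injective : ∀ {a b} → a < period → b < period → orbit a ≡ orbit b → a ≡ b
  orbit-injective {a} {b} a<period b<period same with <-cmp a b
  ... | tri< a<b _ _ = contradiction same (no-early-repeat a<b b<period)
  ... | tri≈ _ a≡b _ = a≡b
  ... | tri> _ _ b<a = contradiction (sym same) (no-early-repeat b<a a<period)

  orbit-≡⇒%≡ : ∀ a b → orbit a ≡ orbit b → a % period ≡ b % period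
  orbit-≡⇒%≡ a b same =
    orbit-injective (m%n<n a period) (m%n<n b period) (trans (orbit-% a) (trans same (sym (orbit-% b))))

  orbit-reachable : ∀ a b → ∃[ t ] fold (orbit a) f t ≡ orbit b
  orbit-reachable a b = b + a * k₀ , (begin
    fold (orbit a) f (b + a * k₀)  ≡⟨ orbit-+ (b + a * k₀) a ⟨
    orbit (b + a * k₀ + a)         ≡⟨ cong orbit (trans (+-assoc b (a * k₀) a) (cong (b +_) (+-comm (a * k₀) a))) ⟩
    orbit (b + (a + a * k₀))       ≡⟨ cong (λ n → orbit (b + n)) (*-suc a k₀) ⟨
    orbit (b + a * period)         ≡⟨ orbit-periodic b a ⟩
    orbit b                        ∎)
    where
      open ≡-Reasoning
      k₀ : ℕ
      k₀ = period ∸ 1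

Corner↔Fin : ∀ {m} → Corner m ↔ Fin (m * (2 * 2))
Corner↔Fin = ↔-sym (↔-trans *↔× (↔-refl ×-↔ ↔-trans *↔× (2↔Bool ×-↔ 2↔Bool)))

_≟ᶜ_ : ∀ {m} → DecidableEquality (Corner m)
_≟ᶜ_ = ≡-dec Fin._≟_ (≡-dec Bool._≟_ Bool._≟_)

segment : ∀ {m} → Corner m → Fin m × Bool
segment (e , i , s) = e , i

α-involutive : ∀ {m} (d : Corner m) → α (α d) ≡ d
α-involutive (e , i , s) = cong (λ s → e , i , s) (not-involutive s)

α-injective : ∀ {m} {d d′ : Corner m} → α d ≡ α d′ → d ≡ d′
α-injective {d = d} {d′} eq = trans (sym (α-involutive d)) (trans (cong α eq) (α-involutive d′))

α-fixedPointFree : ∀ {m} (d : Corner m) → α d ≢ d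
α-fixedPointFree (e , i , false) ()
α-fixedPointFree (e , i , true) ()

segment-≡ : ∀ {m} {d d′ : Corner m} → segment d ≡ segment d′ → d ≡ d′ ⊎ d ≡ α d′
segment-≡ {d = e , i , false} {.e , .i , false} refl = inj₁ refl
segment-≡ {d = e , i , false} {.e , .i , true} refl = inj₂ refl
segment-≡ {d = e , i , true} {.e , .i , false} refl = inj₂ refl
segment-≡ {d = e , i , true} {.e , .i , true} refl = inj₁ refl

edgeParity : ∀ {m} → (Corner m → Bool) → Fin m → Bool
edgeParity c e = c (e , true , false) xor c (e , false , false)

module _ {m} {c : Corner m → Bool} (α-alternating : ∀ d → c (α d) ≡ not (c d)) where
  private
    side : ∀ e i s → c (e , i , s) ≡ s xor c (e , i , false)
    side e i false = refl
    side e i true = α-alternating (e , i , false)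

    edgeParity-from : ∀ e i → edgeParity c e ≡ c (e , i , false) xor c (e , not i , false)
    edgeParity-from e true = refl
    edgeParity-from e false = xor-comm (c (e , true , false)) (c (e , false , false))

  -- c (e , i , s) = s xor c (e , i , false) reduces invariance under λ to one equation per edge
  λ-invariant⇔ : (t : Fin m → Bool) → (∀ d → c (λ-of t d) ≡ c d) ⇔ (∀ e → t e ≡ edgeParity c e)
  λ-invariant⇔ t = mk⇔
    (λ invariant e → trans (sym (xor-cancelʳ (t e) _))
                           (cong (_xor c (e , false , false)) (trans (sym (side e false (t e))) (invariant (e , true , false)))))
    (λ parity → λ { (e , i , s) → begin
      c (e , not i , s xor t e)                                        ≡⟨ side e (not i) (s xor t e) ⟩
      (s xor t e) xor c (e , not i , false)                            ≡⟨ cong (λ t → (s xor t) xor c (e , not i , false)) (trans (parity e) (edgeParity-from e i)) ⟩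
      (s xor (c (e , i , false) xor c (e , not i , false))) xor c (e , not i , false)
                                                                       ≡⟨ cong (_xor c (e , not i , false)) (sym (xor-assoc s _ _)) ⟩
      ((s xor c (e , i , false)) xor c (e , not i , false)) xor c (e , not i , false)
                                                                       ≡⟨ xor-cancelʳ _ _ ⟩
      s xor c (e , i , false)                                          ≡⟨ side e i s ⟨
      c (e , i , s)                                                    ∎ })
    where open ≡-Reasoning

module _ (G : RibbonGraph) where
  private
    C : Set
    C = Corner (nE G)

  σ : C → C
  σ d = ν G (α d)

  ν-injective : ∀ {d d′} → ν G d ≡ ν G d′ → d ≡ d′
  ν-injective {d} {d′} eq = trans (sym (ν-invol G d)) (trans (cong (ν G) eq) (ν-invol G d′))

  σ-injective : ∀ {d d′} → σ d ≡ σ d′ → d ≡ d′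
  σ-injective eq = α-injective (ν-injective eq)

  -- ν y = σ⁽ᵗ⁺²⁾ y forces ν (σ y) = σᵗ (σ y); for t = 0, 1 it contradicts ν resp. α being fixed-point free.
  ν-off-σ-orbit : ∀ t y → ν G y ≢ fold y σ t
  ν-off-σ-orbit zero y eq = ν-fpf G y eq
  ν-off-σ-orbit (suc zero) y eq = α-fixedPointFree y (sym (ν-injective eq))
  ν-off-σ-orbit (suc (suc t)) y eq = ν-off-σ-orbit t (σ y) (begin
    ν G (σ y)          ≡⟨ ν-invol G (α y) ⟩
    α y                ≡⟨ cong α (ν-injective eq) ⟩
    α (α (σ w))        ≡⟨ α-involutive (σ w) ⟩
    fold y σ (suc t)   ≡⟨ iterate-is-fold y σ (suc t) ⟩
    iterate σ (σ y) t  ≡⟨ iterate-is-fold (σ y) σ t ⟨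
    fold (σ y) σ t     ∎)
    where
      open ≡-Reasoning
      w : C
      w = fold y σ t

  vertOf-α : ∀ d → vertOf G (α d) ≡ vertOf G d
  vertOf-α d = sym (Equivalence.from (vertOf-orbit G d (α d)) (inj₁ refl ◅ ε))

  vertOf-ν : ∀ d → vertOf G (ν G d) ≡ vertOf G d
  vertOf-ν d = sym (Equivalence.from (vertOf-orbit G d (ν G d)) (inj₂ refl ◅ ε))

  vertOf-fold-σ : ∀ d j → vertOf G (fold d σ j) ≡ vertOf G d
  vertOf-fold-σ d zero = refl
  vertOf-fold-σ d (suc j) = trans (vertOf-ν _) (trans (vertOf-α _) (vertOf-fold-σ d j))

  vertOf-side : ∀ e i s → vertOf G (e , i , s) ≡ vertOf G (e , i , false)
  vertOf-side e i false = refl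
  vertOf-side e i true = vertOf-α (e , i , false)

  vertOf-segment : ∀ {e i} d → (e , i) ≡ segment d → vertOf G (e , i , false) ≡ vertOf G d
  vertOf-segment (e , i , s) refl = sym (vertOf-side e i s)

  -- The corners on the vertex of r are the σʲ r together with their ν-partners; At j d says that
  -- d is one of these at position j.
  module VertexCycle (r : C) where
    open Cycle (↔⇒↣ Corner↔Fin) σ σ-injective r public

    data At (j : ℕ) (d : C) : Set where
      is-orbit   : orbit j ≡ d → At j d
      is-partner : orbit j ≡ ν G d → At j d

    At? : ∀ j d → Dec (At j d)
    At? j d with orbit j ≟ᶜ d | orbit j ≟ᶜ ν G d
    ... | yes eq | _ = yes (is-orbit eq)
    ... | no _ | yes eq = yes (is-partner eq)
    ... | no ¬orbit | no ¬partner = no λ { (is-orbit eq) → ¬orbit eq ; (is-partner eq) → ¬partner eq }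

    ν-orbit-disjoint : ∀ a b → ν G (orbit a) ≢ orbit b
    ν-orbit-disjoint a b eq with orbit-reachable a b
    ... | t , reach = ν-off-σ-orbit t (orbit a) (trans eq (sym reach))

    At-ν : ∀ {j d} → At j d → At j (ν G d)
    At-ν {d = d} (is-orbit eq) = is-partner (trans eq (sym (ν-invol G d)))
    At-ν (is-partner eq) = is-orbit eq

    partner-α : ∀ j {d} → orbit j ≡ ν G d → orbit (j + (period ∸ 1)) ≡ α d
    partner-α j {d} eq = trans (sym (α-involutive _)) (cong α (ν-injective (begin
      σ (orbit (j + (period ∸ 1)))  ≡⟨ cong orbit (+-suc j (period ∸ 1)) ⟨
      orbit (j + period)            ≡⟨ orbit-+ j period ⟩
      fold (orbit period) σ j       ≡⟨ cong (λ y → fold y σ j) orbit-period ⟩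
      orbit j                       ≡⟨ eq ⟩
      ν G d                         ∎)))
      where open ≡-Reasoning

    At-α : ∀ {j d} → At j d → At (suc j) (α d) ⊎ At (j + (period ∸ 1)) (α d)
    At-α (is-orbit eq) = inj₁ (is-partner (cong σ eq))
    At-α {j} (is-partner eq) = inj₂ (is-orbit (partner-α j eq))

    At-% : ∀ {j d} → At j d → At (j % period) d
    At-% {j} (is-orbit eq) = is-orbit (trans (orbit-% j) eq)
    At-% {j} (is-partner eq) = is-partner (trans (orbit-% j) eq)

    At-unique : ∀ {a b d} → At a d → At b d → a % period ≡ b % period
    At-unique {a} {b} (is-orbit a≡d) (is-orbit b≡d) = orbit-≡⇒%≡ a b (trans a≡d (sym b≡d))
    At-unique {a} {b} (is-partner a≡νd) (is-partner b≡νd) = orbit-≡⇒%≡ a b (trans a≡νd (sym b≡νd))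
    At-unique {a} {b} (is-orbit a≡d) (is-partner b≡νd) =
      contradiction (trans (cong (ν G) a≡d) (sym b≡νd)) (ν-orbit-disjoint a b)
    At-unique {a} {b} (is-partner a≡νd) (is-orbit b≡d) =
      contradiction (trans (cong (ν G) b≡d) (sym a≡νd)) (ν-orbit-disjoint b a)

    vertex⇒At : ∀ {d} → vertOf G r ≡ vertOf G d → ∃[ j ] At j d
    vertex⇒At same = along (is-orbit {0} refl) (Equivalence.to (vertOf-orbit G _ _) same)
      where
        along : ∀ {j x d} → At j x → Star (VStep (ν G)) x d → ∃[ j ] At j d
        along at ε = _ , at
        along at (inj₁ refl ◅ steps) with At-α at
        ... | inj₁ at′ = along at′ steps
        ... | inj₂ at′ = along at′ steps
        along at (inj₂ refl ◅ steps) = along (At-ν at) steps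

    orbitSegment : Fin period → Fin (nE G) × Bool
    orbitSegment j = segment (orbit (toℕ j))

    orbitSegments : List (Fin (nE G) × Bool)
    orbitSegments = tabulate orbitSegment

    orbitSegments-unique : Unique orbitSegments
    orbitSegments-unique = Unique.tabulate⁺ injective
      where
        injective : ∀ {a b} → orbitSegment a ≡ orbitSegment b → a ≡ b
        injective {a} {b} eq with segment-≡ eq
        ... | inj₁ same = toℕ-injective (orbit-injective (toℕ<n a) (toℕ<n b) same)
        ... | inj₂ opposite = contradiction
          (trans (ν-invol G (α (orbit (toℕ b)))) (sym opposite)) (ν-orbit-disjoint (suc (toℕ b)) (toℕ a))

    ∈-orbitSegments⇔ : ∀ {e i} → (e , i) ∈ orbitSegments ⇔ vertOf G (e , i , false) ≡ vertOf G r
    ∈-orbitSegments⇔ {e} {i} = mk⇔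
      (λ e,i∈ → let (k , eq) = ∈-tabulate⁻ {f = orbitSegment} e,i∈
                in trans (vertOf-segment (orbit (toℕ k)) eq) (vertOf-fold-σ r (toℕ k)))
      (λ same → let (k , eq) = At⇒segment (proj₂ (vertex⇒At (sym same)))
                in subst (_∈ orbitSegments) eq (∈-tabulate⁺ {f = orbitSegment} k))
      where
        orbit⇒segment : ∀ j {d} → orbit j ≡ d → ∃[ k ] orbitSegment k ≡ segment d
        orbit⇒segment j eq =
          fromℕ< (m%n<n j period) ,
          cong segment (trans (cong orbit (toℕ-fromℕ< (m%n<n j period))) (trans (orbit-% j) eq))

        At⇒segment : ∀ {j d} → At j d → ∃[ k ] orbitSegment k ≡ segment d
        At⇒segment {j} (is-orbit eq) = orbit⇒segment j eq
        At⇒segment {j} (is-partner eq) = orbit⇒segment (j + (period ∸ 1)) (partner-α j eq)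

    degree≡period : degree G (vertOf G r) ≡ period
    degree≡period = begin
      length segmentsAt       ≡⟨ ↭-length (∼bag⇒↭ (unique∧set⇒bag segmentsAt-unique orbitSegments-unique same-segments)) ⟩
      length orbitSegments    ≡⟨ length-tabulate orbitSegment ⟩
      period                  ∎
      where
        open ≡-Reasoning

        atVertex? : (s : Fin (nE G) × Bool) → Dec (vertOf G (proj₁ s , proj₂ s , false) ≡ vertOf G r)
        atVertex? s = vertOf G (proj₁ s , proj₂ s , false) Fin.≟ vertOf G r

        allSegments : List (Fin (nE G) × Bool)
        allSegments = cartesianProduct (allFin (nE G)) (true ∷ false ∷ [])

        segmentsAt : List (Fin (nE G) × Bool)
        segmentsAt = filter atVertex? allSegments

        segmentsAt-unique : Unique segmentsAt
        segmentsAt-unique =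
          Unique.filter⁺ atVertex? (Unique.cartesianProduct⁺ (Unique.allFin⁺ (nE G)) (((λ ()) ∷ []) ∷ [] ∷ []))

        ∈-allSegments : ∀ s → s ∈ allSegments
        ∈-allSegments (e , true) = ∈-cartesianProduct⁺ (∈-allFin e) (here refl)
        ∈-allSegments (e , false) = ∈-cartesianProduct⁺ (∈-allFin e) (there (here refl))

        same-segments : ∀ {s} → s ∈ segmentsAt ⇔ s ∈ orbitSegments
        same-segments {s} = mk⇔
          (λ s∈ → Equivalence.from ∈-orbitSegments⇔ (proj₂ (∈-filter⁻ atVertex? {xs = allSegments} s∈)))
          (λ s∈ → ∈-filter⁺ atVertex? (∈-allSegments s) (Equivalence.to ∈-orbitSegments⇔ s∈))

    position? : ∀ d → Dec (∃[ j ] At (toℕ {period} j) d)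
    position? d = any? (λ j → At? (toℕ j) d)

    positionParity : ∀ {d} → Dec (∃[ j ] At (toℕ {period} j) d) → Bool
    positionParity (yes (j , _)) = odd (toℕ j)
    positionParity (no _) = false

    parityLabel : C → Bool
    parityLabel d = positionParity (position? d)

    module _ (even : 2 ∣ period) where
      positionParity-At : ∀ {j d} (p : Dec (∃[ i ] At (toℕ {period} i) d)) → At j d → positionParity p ≡ odd j
      positionParity-At {j} (yes (i , at-i)) at = begin
        odd (toℕ i)             ≡⟨ odd-% (toℕ i) period even ⟨
        odd (toℕ i % period)    ≡⟨ cong odd (At-unique at-i at) ⟩
        odd (j % period)        ≡⟨ odd-% j period even ⟩
        odd j                   ∎
        where open ≡-Reasoning
      positionParity-At {j} {d} (no none) at = contradiction
        (fromℕ< (m%n<n j period) , subst (λ n → At n d) (sym (toℕ-fromℕ< (m%n<n j period))) (At-% at)) none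

      parityLabel-At : ∀ {j d} → At j d → parityLabel d ≡ odd j
      parityLabel-At {d = d} = positionParity-At (position? d)

      odd-period∸1 : odd (period ∸ 1) ≡ true
      odd-period∸1 = trans (sym (not-involutive (odd (period ∸ 1)))) (cong not (odd-even even))

      parityLabel-ν : ∀ {d} → vertOf G r ≡ vertOf G d → parityLabel (ν G d) ≡ parityLabel d
      parityLabel-ν {d} same = trans (parityLabel-At (At-ν at)) (sym (parityLabel-At at))
        where
          at : At (proj₁ (vertex⇒At same)) d
          at = proj₂ (vertex⇒At same)

      parityLabel-α : ∀ {d} → vertOf G r ≡ vertOf G d → parityLabel (α d) ≡ not (parityLabel d)
      parityLabel-α {d} same = neighbour (At-α at)
        where
          j : ℕ
          j = proj₁ (vertex⇒At same)

          at : At j d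
          at = proj₂ (vertex⇒At same)

          neighbour : At (suc j) (α d) ⊎ At (j + (period ∸ 1)) (α d) → parityLabel (α d) ≡ not (parityLabel d)
          neighbour (inj₁ at′) = trans (parityLabel-At at′) (cong not (sym (parityLabel-At at)))
          neighbour (inj₂ at′) = begin
            parityLabel (α d)                ≡⟨ parityLabel-At at′ ⟩
            odd (j + (period ∸ 1))           ≡⟨ odd-+ j (period ∸ 1) ⟩
            odd j xor odd (period ∸ 1)       ≡⟨ cong (odd j xor_) odd-period∸1 ⟩
            odd j xor true                   ≡⟨ xor-comm (odd j) true ⟩
            not (odd j)                      ≡⟨ cong not (parityLabel-At at) ⟨
            not (parityLabel d)              ∎
            where open ≡-Reasoning

  record IsAlternating (c : C → Bool) : Set where
    field
      ν-invariant   : ∀ d → c (ν G d) ≡ c d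
      α-alternating : ∀ d → c (α d) ≡ not (c d)

  eulerian⇒alternating : Eulerian G → Σ (C → Bool) IsAlternating
  eulerian⇒alternating eulerian = p , record { ν-invariant = p-ν ; α-alternating = p-α }
    where
      open VertexCycle using (parityLabel; parityLabel-ν; parityLabel-α; degree≡period)

      even : ∀ r → 2 ∣ VertexCycle.period r
      even r = subst (2 ∣_) (degree≡period r) (eulerian (vertOf G r))

      pick : Fin (nV G) → C → Bool
      pick = pickOver Corner↔Fin Fin._≟_ (vertOf G) parityLabel (λ _ → false)

      p : C → Bool
      p d = pick (vertOf G d) d

      local : ∀ d → ∃[ r ] vertOf G r ≡ vertOf G d × (∀ d′ → vertOf G d′ ≡ vertOf G d → p d′ ≡ parityLabel r d′)
      local d =
        let (r , r-at-d , picked) = pickOver-spec Corner↔Fin Fin._≟_ (vertOf G) parityLabel (λ _ → false) d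
        in r , r-at-d , λ d′ same → trans (cong (λ v → pick v d′) same) (cong-app picked d′)

      p-ν : ∀ d → p (ν G d) ≡ p d
      p-ν d =
        let (r , r-at-d , agrees) = local d
        in trans (agrees (ν G d) (vertOf-ν d)) (trans (parityLabel-ν r (even r) r-at-d) (sym (agrees d refl)))

      p-α : ∀ d → p (α d) ≡ not (p d)
      p-α d =
        let (r , r-at-d , agrees) = local d
        in trans (agrees (α d) (vertOf-α d)) (trans (parityLabel-α r (even r) r-at-d) (cong not (sym (agrees d refl))))

  vertex-invariant : ∀ {B : Set} (h : C → B) → (∀ d → h (α d) ≡ h d) → (∀ d → h (ν G d) ≡ h d) →
                     ∀ {d d′} → vertOf G d ≡ vertOf G d′ → h d ≡ h d′
  vertex-invariant h h-α h-ν same = along (Equivalence.to (vertOf-orbit G _ _) same)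
    where
      along : ∀ {d d′} → Star (VStep (ν G)) d d′ → h d ≡ h d′
      along ε = refl
      along {d} (inj₁ refl ◅ steps) = trans (sym (h-α d)) (along steps)
      along {d} (inj₂ refl ◅ steps) = trans (sym (h-ν d)) (along steps)

  flipAt : (C → Bool) → (Fin (nV G) → Bool) → C → Bool
  flipAt p x d = p d xor x (vertOf G d)

  module _ {p : C → Bool} (p-alternating : IsAlternating p) where
    open IsAlternating p-alternating

    flipAt-alternating : ∀ x → IsAlternating (flipAt p x)
    flipAt-alternating x = record
      { ν-invariant = λ d → cong₂ _xor_ (ν-invariant d) (cong x (vertOf-ν d))
      ; α-alternating = λ d → trans (cong₂ _xor_ (α-alternating d) (cong x (vertOf-α d)))
                                    (sym (not-distribˡ-xor (p d) (x (vertOf G d))))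
      }

    alternating⇒flipAt : ∀ {c} → IsAlternating c → ∃[ x ] (∀ d → c d ≡ flipAt p x d)
    alternating⇒flipAt {c} c-alternating = x , λ d → begin
      c d                       ≡⟨ xor-cancelˡ (p d) (c d) ⟨
      p d xor (p d xor c d)     ≡⟨ cong (p d xor_) (x-spec d) ⟨
      flipAt p x d              ∎
      where
        open ≡-Reasoning
        module c = IsAlternating c-alternating

        difference : C → Bool
        difference d = p d xor c d

        on-vertex : ∀ {d d′} → vertOf G d ≡ vertOf G d′ → difference d ≡ difference d′
        on-vertex = vertex-invariant difference
          (λ d → trans (cong₂ _xor_ (α-alternating d) (c.α-alternating d)) (xor-annihilates-not (p d) (c d)))
          (λ d → cong₂ _xor_ (ν-invariant d) (c.ν-invariant d))

        x : Fin (nV G) → Bool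
        x = pickOver Corner↔Fin Fin._≟_ (vertOf G) difference false

        x-spec : ∀ d → x (vertOf G d) ≡ difference d
        x-spec d = let (y , same , picked) = pickOver-spec Corner↔Fin Fin._≟_ (vertOf G) difference false d
                   in trans picked (on-vertex same)

  endpoint : Fin (nE G) → Bool → Fin (nV G)
  endpoint e i = vertOf G (e , i , false)

  constant-along-edges⇒constant : Connected G → ∀ {B : Set} (f : Fin (nV G) → B) →
    (∀ e → f (endpoint e true) ≡ f (endpoint e false)) → Constant f
  constant-along-edges⇒constant (_ , connected) f along-edges u w with connected u w
  ... | inj₁ refl = refl
  ... | inj₂ (d , d′ , refl , refl , path) = along path
    where
      across : ∀ e i → f (endpoint e i) ≡ f (endpoint e (not i))
      across e true = along-edges e
      across e false = sym (along-edges e)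

      step : ∀ {d d′} → AStep (twist G) (ν G) d d′ → f (vertOf G d) ≡ f (vertOf G d′)
      step {d} (inj₁ refl) = cong f (sym (vertOf-α d))
      step {e , i , s} (inj₂ (inj₁ refl)) =
        trans (cong f (vertOf-side e i s))
              (trans (across e i) (cong f (sym (vertOf-side e (not i) (s xor twist G e)))))
      step {d} (inj₂ (inj₂ refl)) = cong f (sym (vertOf-ν d))

      along : ∀ {d d′} → Star (AStep (twist G) (ν G)) d d′ → f (vertOf G d) ≡ f (vertOf G d′)
      along ε = refl
      along (s ◅ steps) = trans (step s) (along steps)

  petrialOf : (C → Bool) → Subset (nE G)
  petrialOf c = tabulateᵥ (λ e → twist G e xor edgeParity c e)

  colourable⇔alternating : ∀ A →
    CheckerboardColourable (partialPetrial G A) ⇔ (∃[ c ] IsAlternating c × petrialOf c ≡ A)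
  colourable⇔alternating A = mk⇔
    (λ (c , λ-invariant , ν-invariant , α-changes) →
      let α-alternating = λ d → ¬-not (α-changes d)
      in c , record { ν-invariant = ν-invariant ; α-alternating = α-alternating }
           , Equivalence.from (petrialOf-≡ {c}) (Equivalence.to (λ-invariant⇔ α-alternating (twist′ A)) λ-invariant))
    (λ (c , c-alternating , eq) →
      let open IsAlternating c-alternating
      in c , Equivalence.from (λ-invariant⇔ α-alternating (twist′ A)) (Equivalence.to (petrialOf-≡ {c}) eq)
           , ν-invariant , λ d same → not-¬ refl (trans (sym same) (α-alternating d)))
    where
      twist′ : Subset (nE G) → Fin (nE G) → Bool
      twist′ A e = twist G e xor lookup A e

      petrialOf-≡ : ∀ {c} → petrialOf c ≡ A ⇔ (∀ e → twist′ A e ≡ edgeParity c e)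
      petrialOf-≡ {c} = mk⇔
        (λ eq e → xor-exchange (twist G e) (Equivalence.to tabulate-≡⇔ (trans eq (sym (tabulate∘lookup A))) e))
        (λ parity → trans (Equivalence.from tabulate-≡⇔ (λ e → xor-exchange (twist G e) (parity e))) (tabulate∘lookup A))

  petrialOf-cong : ∀ {c c′} → (∀ d → c d ≡ c′ d) → petrialOf c ≡ petrialOf c′
  petrialOf-cong c≗c′ = tabulate-cong (λ e → cong (twist G e xor_) (cong₂ _xor_ (c≗c′ _) (c≗c′ _)))

  coboundary : (Fin (nV G) → Bool) → Fin (nE G) → Bool
  coboundary x e = x (endpoint e true) xor x (endpoint e false)

  edgeParity-flipAt : ∀ p x e → edgeParity (flipAt p x) e ≡ edgeParity p e xor coboundary x e
  edgeParity-flipAt p x e = interchange (p (e , true , false)) (x (endpoint e true)) (p (e , false , false)) (x (endpoint e false))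

  petrialOf-flipAt-≡⇔ : ∀ p x x′ → petrialOf (flipAt p x) ≡ petrialOf (flipAt p x′) ⇔ (∀ e → coboundary x e ≡ coboundary x′ e)
  petrialOf-flipAt-≡⇔ p x x′ = mk⇔
    (λ eq e → xor-cancelˡ-≡ (edgeParity p e) (begin
      edgeParity p e xor coboundary x e     ≡⟨ edgeParity-flipAt p x e ⟨
      edgeParity (flipAt p x) e             ≡⟨ xor-cancelˡ-≡ (twist G e) (Equivalence.to tabulate-≡⇔ eq e) ⟩
      edgeParity (flipAt p x′) e            ≡⟨ edgeParity-flipAt p x′ e ⟩
      edgeParity p e xor coboundary x′ e    ∎))
    (λ same → tabulate-cong λ e → cong (twist G e xor_) (begin
      edgeParity (flipAt p x) e             ≡⟨ edgeParity-flipAt p x e ⟩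
      edgeParity p e xor coboundary x e     ≡⟨ cong (edgeParity p e xor_) (same e) ⟩
      edgeParity p e xor coboundary x′ e    ≡⟨ edgeParity-flipAt p x′ e ⟨
      edgeParity (flipAt p x′) e            ∎))
    where open ≡-Reasoning

  coboundary-≡⇔ : Connected G → ∀ x x′ → (∀ e → coboundary x e ≡ coboundary x′ e) ⇔ Constant (λ v → x v xor x′ v)
  coboundary-≡⇔ connected x x′ = mk⇔
    (λ same → constant-along-edges⇒constant connected (λ v → x v xor x′ v) λ e →
      xor-transpose (x (endpoint e true)) (x (endpoint e false)) (x′ (endpoint e true)) (x′ (endpoint e false)) (same e))
    (λ constant e →
      xor-transpose (x (endpoint e true)) (x′ (endpoint e true)) (x (endpoint e false)) (x′ (endpoint e false)) (constant _ _))

  colourable⇔flipAt : ∀ {p} → IsAlternating p → ∀ A →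
    CheckerboardColourable (partialPetrial G A) ⇔ (∃[ x ] petrialOf (flipAt p x) ≡ A)
  colourable⇔flipAt {p} p-alternating A = mk⇔
    (λ (c , c-alternating , eq) →
      let (x , c≗flip) = alternating⇒flipAt p-alternating c-alternating
      in x , trans (petrialOf-cong (λ d → sym (c≗flip d))) eq)
    (λ (x , eq) → flipAt p x , flipAt-alternating p-alternating x , eq)
    ⇔-∘ colourable⇔alternating A

corollary4p7 : (G : RibbonGraph) → Connected G → Eulerian G →
    Σ[ L ∈ List (Subset (nE G)) ]
      (Unique L × (length L ≡ 2 ^ (nV G ∸ 1)) ×
       (∀ A → (A ∈ L) ⇔ CheckerboardColourable (partialPetrial G A)))
corollary4p7 G connected eulerian =
  let (p , p-alternating) = eulerian⇒alternating G eulerian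
      (L , unique , size , members) =
        image-size-modulo-constants (proj₁ connected) (λ x → petrialOf G (flipAt G p x))
          (λ x x′ → coboundary-≡⇔ G connected x x′ ⇔-∘ petrialOf-flipAt-≡⇔ G p x x′)
  in L , unique , size , λ A → ⇔-sym (colourable⇔flipAt G p-alternating A) ⇔-∘ members A
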